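{- Let $\mathbf{q}=(q_1,\dots,q_a)\in\prod_{j=1}^a L(v_1,x_j)$, let $s=s(\mathbf{q})$, and let $\mathcal{C}'_{\mathbf{q}}$ be the set of proper $L_X$-colorings $c$ of $M_{\mathbf{q}}$ with $c(v_1,x_j)=q_j$ for all $j\in[a]$. For each $j\in[a]$ let $d_j=|L(v_2,x_j)\cap(\{q_i: s_{q_i}=1\}\cup\{q_j\})|$. Then: (i) $d_j\le s+1$ for each $j\in[a]$, and $\sum_{j=1}^a d_j\le a$; (ii) \[ |\mathcal{C}'_{\mathbf{q}}| \ge \prod_{j=1}^a(n+a-1-d_j)\left(\prod_{i=3}^n(n+a-i+1)\right)^s\left(\prod_{i=3}^n(n+a-i)\right)^{a-s}. \]
   Context: Standing setting: $n,a$ are integers with $2\le n\le a$; $M=K_n$ with $V(M)=\{v_1,\dots,v_n\}$; $K_{a,b}$ has partite sets $X=\{x_1,\dots,x_a\}$ and $Y=\{y_1,\dots,y_b\}$ with $b=\left(\prod_{i=0}^{n-1}(n+a-1-i)\right)^a-1$; $H=M\square K_{a,b}$ (Cartesian product). $L$ is an $(n+a-1)$-assignment for $H$ such that for each $i\in[n]$ the lists $L(v_i,x_1),\dots,L(v_i,x_a)$ are pairwise disjoint. $H_X$ is the subgraph of $H$ induced by $V_X=\{(v_i,x_j): i\in[n],j\in[a]\}$ (so $(v_i,x_j)\sim(v_{i'},x_{j'})$ in $H_X$ iff $j=j'$ and $i\ne i'$), $L_X$ is the restriction of $L$ to $V_X$, and $\mathcal{C}_X$ is the set of all proper $L_X$-colorings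 of $H_X$. For each color $q\in\bigcup_{j=1}^a L(v_1,x_j)$, $s_q=1$ if there exists $c\in\mathcal{C}_X$ with $|c^{ -1}(q)|=n$, and $s_q=0$ otherwise; for $\mathbf{q}\in\prod_{j=1}^a L(v_1,x_j)$, $s(\mathbf{q})=\sum_{j=1}^a s_{q_j}$. The graph $M_{\mathbf{q}}$ has vertex set $V_X$ and its edges are as follows: for each $j\in[a]$, if $s_{q_j}=0$ then $\{(v_i,x_j): i\in[n]\}$ is a clique; if $s_{q_j}=1$ then $(v_1,x_j)$ is adjacent to every vertex of $\{(v_2,x_{j'}): j'\in[a], j'\ne j\}$ and $\{(v_i,x_j): 2\le i\le n\}$ is a clique; there are no other edges. A product over an empty range equals $1$. -}

module Defs where

open import Data.Nat using (ℕ; zero; suc; _+_; _*_; _∸_; _^_; _≤_; s≤s; z≤n; _≡ᵇ_)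
open import Data.Bool using (Bool; true; false; _∨_; _∧_; if_then_else_)
open import Data.Fin using (Fin; zero; suc)
open import Data.Sum using (_⊎_; inj₁; inj₂)
open import Data.Product using (Σ; _×_; _,_)
open import Data.List using (List; []; _∷_; length)
open import Data.List.Membership.Propositional using (_∈_; _∉_)
open import Data.List.Relation.Unary.Unique.Propositional using (Unique)
open import Relation.Binary.PropositionalEquality using (_≡_; _≢_)
open import Relation.Nullary using (¬_)
open import Function.Bundles using (_⇔_)

sumFin : ∀ {a} → (Fin a → ℕ) → ℕ
sumFin {zero}  f = 0
sumFin {suc a} f = f zero + sumFin (λ j → f (suc j))

prodFin : ∀ {a} → (Fin a → ℕ) → ℕ
prodFin {zero}  f = 1
prodFin {suc a} f = f zero * prodFin (λ j → f (suc j))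

prodFrom : ℕ → ℕ → (ℕ → ℕ) → ℕ
prodFrom lo zero    f = 1
prodFrom lo (suc k) f = f lo * prodFrom (suc lo) k f

-- ∏_{i=lo}^{hi} f i  (empty, i.e. = 1, when hi < lo)
prodRange : ℕ → ℕ → (ℕ → ℕ) → ℕ
prodRange lo hi f = prodFrom lo (suc hi ∸ lo) f

bSize : ℕ → ℕ → ℕ
bSize n a = (prodFrom 0 n (λ i → n + a ∸ 1 ∸ i)) ^ a ∸ 1

v₁ : ∀ {n} → 2 ≤ n → Fin n
v₁ (s≤s (s≤s _)) = zero

v₂ : ∀ {n} → 2 ≤ n → Fin n
v₂ (s≤s (s≤s _)) = suc zero

-- Vertices of H = K_n □ K_{a,b}: (i , inj₁ j) is (v_i , x_j), (i , inj₂ k) is (v_i , y_k).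
-- A list assignment of H: each vertex gets a list of colours (natural numbers).
Assignment : ℕ → ℕ → ℕ → Set
Assignment n a b = Fin n → Fin a ⊎ Fin b → List ℕ

IsKAssignment : ∀ {n a b} → ℕ → Assignment n a b → Set
IsKAssignment k L = ∀ i u → Unique (L i u) × length (L i u) ≡ k

XListsDisjoint : ∀ {n a b} → Assignment n a b → Set
XListsDisjoint {n} {a} L =
  ∀ (i : Fin n) (j j' : Fin a) → j ≢ j' → ∀ x → x ∈ L i (inj₁ j) → x ∉ L i (inj₁ j')

ColX : ℕ → ℕ → Set
ColX n a = Fin n → Fin a → ℕ

IsLXCol : ∀ {n a b} → Assignment n a b → ColX n a → Set
IsLXCol L c = ∀ i j → c i j ∈ L i (inj₁ j)

AdjHX : ∀ {n a} → Fin n × Fin a → Fin n × Fin a → Set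
AdjHX (i , j) (i' , j') = j ≡ j' × i ≢ i'

IsProper : ∀ {n a} → (Fin n × Fin a → Fin n × Fin a → Set) → ColX n a → Set
IsProper Adj c = ∀ i j i' j' → Adj (i , j) (i' , j') → c i j ≢ c i' j'

InCX : ∀ {n a b} → Assignment n a b → ColX n a → Set
InCX L c = IsLXCol L c × IsProper AdjHX c

preimageSize : ∀ {n a} → ColX n a → ℕ → ℕ
preimageSize c q = sumFin (λ i → sumFin (λ j → if c i j ≡ᵇ q then 1 else 0))

IsSIndicator : ∀ {n a b} → Assignment n a b → (ℕ → Bool) → Set
IsSIndicator {n} {a} L sflag =
  ∀ q → (sflag q ≡ true) ⇔ Σ (ColX n a) (λ c → InCX L c × preimageSize c q ≡ n)

bit : Bool → ℕ
bit true  = 1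
bit false = 0

sOf : ∀ {a} → (ℕ → Bool) → (Fin a → ℕ) → ℕ
sOf sflag q = sumFin (λ j → bit (sflag (q j)))

data EdgeM {n a} (h : 2 ≤ n) (sflag : ℕ → Bool) (q : Fin a → ℕ)
         : Fin n × Fin a → Fin n × Fin a → Set where
  clique0 : ∀ {i i' j} → sflag (q j) ≡ false → i ≢ i' → EdgeM h sflag q (i , j) (i' , j)
  cross1  : ∀ {j j'} → sflag (q j) ≡ true → j ≢ j' →
            EdgeM h sflag q (v₁ h , j) (v₂ h , j')
  clique1 : ∀ {i i' j} → sflag (q j) ≡ true → i ≢ v₁ h → i' ≢ v₁ h → i ≢ i' →
            EdgeM h sflag q (i , j) (i' , j)

AdjM : ∀ {n a} (h : 2 ≤ n) (sflag : ℕ → Bool) (q : Fin a → ℕ) →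
       Fin n × Fin a → Fin n × Fin a → Set
AdjM h sflag q u w = EdgeM h sflag q u w ⊎ EdgeM h sflag q w u

InC'q : ∀ {n a b} (h : 2 ≤ n) → Assignment n a b → (ℕ → Bool) → (Fin a → ℕ) →
        ColX n a → Set
InC'q h L sflag q c =
  IsLXCol L c × IsProper (AdjM h sflag q) c × (∀ j → c (v₁ h) j ≡ q j)

countᵇ : (ℕ → Bool) → List ℕ → ℕ
countᵇ p []       = 0
countᵇ p (x ∷ xs) = (if p x then 1 else 0) + countᵇ p xs

inSj : ∀ {a} → (ℕ → Bool) → (Fin a → ℕ) → Fin a → ℕ → Bool
inSj sflag q j x = (x ≡ᵇ q j) ∨ anyFin (λ i → sflag (q i) ∧ (x ≡ᵇ q i))
  where
    anyFin : ∀ {m} → (Fin m → Bool) → Bool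
    anyFin {zero}  g = false
    anyFin {suc m} g = g zero ∨ anyFin (λ k → g (suc k))

-- d_j = |L(v₂,x_j) ∩ ({q_i : s_{q_i}=1} ∪ {q_j})|  (L(v₂,x_j) has no repetitions)
dOf : ∀ {n a b} (h : 2 ≤ n) → Assignment n a b → (ℕ → Bool) → (Fin a → ℕ) → Fin a → ℕ
dOf h L sflag q j = countᵇ (inSj sflag q j) (L (v₂ h) (inj₁ j))

-- |S| ≥ N for a set S of colourings given by a predicate:
-- there are N pairwise distinct (as functions) members of S.
AtLeast : ∀ {n a} → ℕ → (ColX n a → Set) → Set
AtLeast {n} {a} N P =
  Σ (Fin N → ColX n a) λ f →
    (∀ k → P (f k)) × (∀ k k' → (∀ i j → f k i j ≡ f k' i j) → k ≡ k')

-- Colourings in C'_q are built column by column, greedily down each column: (v₁,x_j) gets q_j,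
-- (v₂,x_j) any of the at least n+a-1-d_j colours of its list outside {q_i : s_{q_i} = 1} ∪ {q_j},
-- and (v_i,x_j) for i ≥ 3 a colour avoiding those of (v₂,x_j),…,(v_{i-1},x_j), and q_j too when
-- s_{q_j} = 0, which leaves n+a-i+1 resp. n+a-i choices. Such colourings respect every edge of
-- M_q, and distinct choices give distinct colourings.
-- For (i), the colours counted by d_j lie in {q_j} ∪ {q_i : s_{q_i} = 1}, a set of at most s+1
-- elements; as the lists L(v₂,x_j) are pairwise disjoint, the sets counted by the various d_j
-- are moreover disjoint subsets of {q_1,…,q_a}.
module Submission where

open import Defs
open import Data.Nat using (ℕ; _+_; _*_; _∸_; _^_; _≤_)
open import Data.Fin using (Fin)
open import Data.Sum using (inj₁)
open import Data.Bool using (Bool)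
open import Data.Product using (_×_)
open import Data.List.Membership.Propositional using (_∈_)

open import Data.Bool using (true; false; T; _∧_; _∨_)
open import Data.Bool.Properties using (T-∨; T-∧; T-≡; ∧-zeroʳ)
open import Data.Empty using (⊥-elim)
open import Data.Fin using (zero; suc; inject≤; remQuot; combine)
open import Data.Fin.Properties using (inject≤-injective; combine-remQuot; injective⇒≤)
open import Data.List using (List; []; _∷_; length; filter; concat; tabulate; lookup)
open import Data.List.Membership.DecPropositional Data.Nat._≟_ using (_∈?_; _∉?_)
open import Data.List.Membership.Propositional using (_∉_)
open import Data.List.Membership.Propositional.Properties
  using (∈-lookup; ∈-filter⁻; ∈-concat⁻′; ∈-tabulate⁺; ∈-tabulate⁻)
open import Data.List.Membership.Setoid.Properties using (index-injective)
open import Data.List.Properties using (length-++; length-tabulate)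
open import Data.List.Relation.Binary.Subset.Propositional using (_⊆_)
import Data.List.Relation.Unary.All as All
import Data.List.Relation.Unary.All.Properties as Allₚ
import Data.List.Relation.Unary.AllPairs.Properties as AllPairsₚ
open import Data.List.Relation.Unary.Any using (here; there)
open import Data.List.Relation.Unary.Unique.Propositional using (Unique; _∷_)
open import Data.List.Relation.Unary.Unique.Propositional.Properties using (filter⁺; concat⁺)
open import Data.Nat using (zero; suc; z≤n; s≤s; _<_; _≡ᵇ_)
open import Data.Nat.Properties
  using ( +-comm; +-suc; *-assoc; m+n∸m≡n; +-∸-assoc; ∸-monoʳ-≤; ≤-trans; m≤m+n; m≤n⇒m≤1+n
        ; ≡ᵇ⇒≡; ≡⇒≡ᵇ; *-commutativeSemigroup; module ≤-Reasoning )
open import Algebra.Properties.CommutativeSemigroup *-commutativeSemigroup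
  using (interchange; x∙yz≈y∙xz)
open import Data.Product using (∃; _,_; proj₁; proj₂; uncurry)
open import Data.Product.Relation.Binary.Pointwise.NonDependent using (Pointwise)
open import Data.Sum using (_⊎_; inj₂)
open import Data.Vec.Functional using () renaming (_∷_ to _∷ᶠ_)
open import Function using (_∘_; id; Equivalence; Injective)
open import Relation.Binary.PropositionalEquality
  using (_≡_; _≢_; refl; sym; trans; cong; cong₂; subst; setoid; _≗_; module ≡-Reasoning)
open import Relation.Nullary using (¬_; does; contradiction)
open import Relation.Nullary.Decidable using (T?)
open import Relation.Unary using (Decidable)
open import Relation.Unary.Properties using (∁?)

private
  variable
    A B : Set
    m N N₁ N₂ : ℕ

record Family (N : ℕ) {A : Set} (_≈_ : A → A → Set) (P : A → Set) : Set where
  constructor family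
  field
    member    : Fin N → A
    satisfies : ∀ k → P (member k)
    distinct  : ∀ k k' → member k ≈ member k' → k ≡ k'

module _ {_≈_ : A → A → Set} {P : A → Set} where

  family-one : ∀ x → P x → Family 1 _≈_ P
  family-one x px = family (λ _ → x) (λ _ → px) λ { zero zero _ → refl }

  family-≤ : m ≤ N → Family N _≈_ P → Family m _≈_ P
  family-≤ m≤N (family f ok inj) =
    family (f ∘ (λ k → inject≤ k m≤N)) (ok ∘ (λ k → inject≤ k m≤N))
      λ k k' e → inject≤-injective m≤N m≤N k k' (inj _ _ e)

  family-map : {_≈′_ : B → B → Set} {Q : B → Set} → Family N _≈_ P → (g : A → B) →
    (∀ {x y} → g x ≈′ g y → x ≈ y) → (∀ {x} → P x → Q (g x)) → Family N _≈′_ Q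
  family-map (family f ok inj) g reflect preserve =
    family (g ∘ f) (λ k → preserve {f k} (ok k)) λ k k' e → inj k k' (reflect {f k} {f k'} e)

  family-Σ : {_≈′_ : B → B → Set} {Q : A → B → Set} → Family N₁ _≈_ P →
    (∀ {x} → P x → Family N₂ _≈′_ (Q x)) →
    Family (N₁ * N₂) (Pointwise _≈_ _≈′_) (λ (x , y) → P x × Q x y)
  family-Σ {N₁ = N₁} {N₂ = N₂} {_≈′_ = _≈′_} {Q = Q} (family f ok inj) g =
    family (pick ∘ remQuot {N₁} N₂) (λ k → pick-ok (remQuot {N₁} N₂ k)) pick∘remQuot-injective
    where
    open Family
    pick : Fin N₁ × Fin N₂ → _
    pick (t , u) = f t , member (g (ok t)) u

    pick-ok : ∀ p → P (proj₁ (pick p)) × Q (proj₁ (pick p)) (proj₂ (pick p))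
    pick-ok (t , u) = ok t , satisfies (g (ok t)) u

    pick-injective : ∀ p p' → Pointwise _≈_ _≈′_ (pick p) (pick p') → p ≡ p'
    pick-injective (t , u) (t' , u') (e , e') with inj t t' e
    ... | refl = cong (t ,_) (distinct (g (ok t)) u u' e')

    pick∘remQuot-injective : ∀ k k' →
      Pointwise _≈_ _≈′_ (pick (remQuot {N₁} N₂ k)) (pick (remQuot {N₁} N₂ k')) → k ≡ k'
    pick∘remQuot-injective k k' e = begin
      k                                      ≡⟨ combine-remQuot {N₁} N₂ k ⟨
      uncurry combine (remQuot {N₁} N₂ k)    ≡⟨ cong (uncurry combine) (pick-injective _ _ e) ⟩
      uncurry combine (remQuot {N₁} N₂ k')   ≡⟨ combine-remQuot {N₁} N₂ k' ⟩
      k'                                     ∎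
      where open ≡-Reasoning

family-columns : ∀ {n a} {N : Fin a → ℕ} {P : Fin a → (Fin n → ℕ) → Set} →
  (∀ j → Family (N j) _≗_ (P j)) →
  Family (prodFin N) (λ c c' → ∀ i j → c i j ≡ c' i j) (λ (c : ColX n a) → ∀ j → P j (λ i → c i j))
family-columns {a = zero}  _       = family-one (λ _ ()) (λ ())
family-columns {a = suc a} columns =
  family-map (family-Σ (columns zero) (λ _ → family-columns (columns ∘ suc)))
    (λ (col , c) i → col i ∷ᶠ c i) (λ e → (λ i → e i zero) , (λ i j → e i (suc j)))
    (λ (p , ps) → λ { zero → p ; (suc j) → ps j })

lookup-injective : ∀ {xs : List A} → Unique xs → Injective _≡_ _≡_ (lookup xs)
lookup-injective (_ ∷ _)      {zero}  {zero}  _ = refl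
lookup-injective (x∉xs ∷ _)   {zero}  {suc j} e = ⊥-elim (All.lookup x∉xs (∈-lookup j) e)
lookup-injective (x∉xs ∷ _)   {suc i} {zero}  e = ⊥-elim (All.lookup x∉xs (∈-lookup i) (sym e))
lookup-injective (_ ∷ unique) {suc i} {suc j} e = cong suc (lookup-injective unique e)

family-lookup : ∀ {xs : List A} → Unique xs → Family (length xs) _≡_ (_∈ xs)
family-lookup {xs = xs} unique = family (lookup xs) ∈-lookup λ k k' → lookup-injective unique

family-filter : ∀ {P : A → Set} (P? : Decidable P) {xs} → Unique xs →
  Family (length (filter P? xs)) _≡_ (λ x → x ∈ xs × P x)
family-filter P? unique = family-map (family-lookup (filter⁺ P? unique)) id id (∈-filter⁻ P?)

family-∈⇒≤ : ∀ {ys : List A} → Family N _≡_ (_∈ ys) → N ≤ length ys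
family-∈⇒≤ (family f ok inj) =
  injective⇒≤ (λ {k} {k'} e → inj k k' (index-injective (setoid _) (ok k) (ok k') e))

unique-⊆⇒length≤ : ∀ {xs ys : List A} → Unique xs → xs ⊆ ys → length xs ≤ length ys
unique-⊆⇒length≤ unique xs⊆ys = family-∈⇒≤ (family-map (family-lookup unique) id id xs⊆ys)

module _ {P : A → Set} (P? : Decidable P) where

  length-filter-∁ : ∀ xs → length (filter (∁? P?) xs) ≡ length xs ∸ length (filter P? xs)
  length-filter-∁ xs = begin
    length (filter (∁? P?) xs)
      ≡⟨ m+n∸m≡n (length (filter P? xs)) _ ⟨
    length (filter P? xs) + length (filter (∁? P?) xs) ∸ length (filter P? xs)
      ≡⟨ cong (_∸ length (filter P? xs)) (partition-length xs) ⟩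
    length xs ∸ length (filter P? xs)
      ∎
    where
    open ≡-Reasoning
    partition-length : ∀ xs → length (filter P? xs) + length (filter (∁? P?) xs) ≡ length xs
    partition-length []       = refl
    partition-length (x ∷ xs) with does (P? x)
    ... | true  = cong suc (partition-length xs)
    ... | false = trans (+-suc _ _) (cong suc (partition-length xs))

countᵇ≡length-filter : ∀ p xs → countᵇ p xs ≡ length (filter (T? ∘ p) xs)
countᵇ≡length-filter p []       = refl
countᵇ≡length-filter p (x ∷ xs) with p x
... | true  = cong suc (countᵇ≡length-filter p xs)
... | false = countᵇ≡length-filter p xs

anyᵇ : (Fin m → Bool) → Bool
anyᵇ {zero}  g = false
anyᵇ {suc m} g = g zero ∨ anyᵇ (g ∘ suc)

anyᵇ⁻ : (g : Fin m → Bool) → T (anyᵇ g) → ∃ λ i → T (g i)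
anyᵇ⁻ {suc m} g t with Equivalence.to T-∨ t
... | inj₁ t₀ = zero , t₀
... | inj₂ t′ = let i , tᵢ = anyᵇ⁻ (g ∘ suc) t′ in suc i , tᵢ

anyᵇ⁺ : (g : Fin m → Bool) → ∀ i → T (g i) → T (anyᵇ g)
anyᵇ⁺ g zero    t = Equivalence.from T-∨ (inj₁ t)
anyᵇ⁺ g (suc i) t = Equivalence.from T-∨ (inj₂ (anyᵇ⁺ (g ∘ suc) i t))

x≡ᵇ1+x≡false : ∀ x → (x ≡ᵇ suc x) ≡ false
x≡ᵇ1+x≡false zero    = refl
x≡ᵇ1+x≡false (suc x) = x≡ᵇ1+x≡false x

private
  dummy-vanishes : ∀ x s b → ((x ≡ᵇ suc x) ∨ ((s ∧ (x ≡ᵇ suc x)) ∨ b)) ≡ b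
  dummy-vanishes x s b rewrite x≡ᵇ1+x≡false x | ∧-zeroʳ s = refl

-- The disjunction over i in inSj is local to Defs; it is exposed as inSj itself applied to
-- q with a dummy colour suc x prepended, which never equals x.
inSj-dummy : ∀ {a} sflag (q : Fin a → ℕ) x →
  inSj sflag (suc x ∷ᶠ q) zero x ≡ anyᵇ (λ i → sflag (q i) ∧ (x ≡ᵇ q i))
inSj-dummy {zero}  sflag q x = dummy-vanishes x (sflag (suc x)) false
inSj-dummy {suc a} sflag q x = begin
  inSj sflag (suc x ∷ᶠ q) zero x
    ≡⟨ trans (dummy-vanishes x (sflag (suc x)) _)
             (cong ((sflag (q zero) ∧ (x ≡ᵇ q zero)) ∨_) (sym (dummy-vanishes x (sflag (suc x)) _))) ⟩
  (sflag (q zero) ∧ (x ≡ᵇ q zero)) ∨ inSj sflag (suc x ∷ᶠ (q ∘ suc)) zero x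
    ≡⟨ cong ((sflag (q zero) ∧ (x ≡ᵇ q zero)) ∨_) (inSj-dummy sflag (q ∘ suc) x) ⟩
  anyᵇ (λ i → sflag (q i) ∧ (x ≡ᵇ q i))
    ∎
  where open ≡-Reasoning

module _ {a} (sflag : ℕ → Bool) (q : Fin a → ℕ) where

  inSj-∨ : ∀ j x → inSj sflag q j x ≡ (x ≡ᵇ q j) ∨ anyᵇ (λ i → sflag (q i) ∧ (x ≡ᵇ q i))
  inSj-∨ j x =
    cong ((x ≡ᵇ q j) ∨_) (trans (sym (dummy-vanishes x (sflag (suc x)) _)) (inSj-dummy sflag q x))

  inSj⁻ : ∀ {j x} → T (inSj sflag q j x) → x ≡ q j ⊎ ∃ λ i → sflag (q i) ≡ true × x ≡ q i
  inSj⁻ {j} {x} t with Equivalence.to T-∨ (subst T (inSj-∨ j x) t)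
  ... | inj₁ x≡qj = inj₁ (≡ᵇ⇒≡ x (q j) x≡qj)
  ... | inj₂ hit  =
    let i , tᵢ = anyᵇ⁻ _ hit
        flag , x≡qi = Equivalence.to T-∧ tᵢ
    in inj₂ (i , Equivalence.to T-≡ flag , ≡ᵇ⇒≡ x (q i) x≡qi)

  inSj⁺-self : ∀ j → T (inSj sflag q j (q j))
  inSj⁺-self j = subst T (sym (inSj-∨ j (q j))) (Equivalence.from T-∨ (inj₁ (≡⇒≡ᵇ (q j) (q j) refl)))

  inSj⁺-flagged : ∀ j {i} → sflag (q i) ≡ true → T (inSj sflag q j (q i))
  inSj⁺-flagged j {i} flag = subst T (sym (inSj-∨ j (q i))) (Equivalence.from T-∨ (inj₂
    (anyᵇ⁺ _ i (Equivalence.from T-∧ (Equivalence.from T-≡ flag , ≡⇒≡ᵇ (q i) (q i) refl)))))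

selected : ∀ {a} → (Fin a → Bool) → (Fin a → ℕ) → List ℕ
selected {zero}  b q = []
selected {suc a} b q with b zero
... | true  = q zero ∷ selected (b ∘ suc) (q ∘ suc)
... | false = selected (b ∘ suc) (q ∘ suc)

length-selected : ∀ {a} (b : Fin a → Bool) q → length (selected b q) ≡ sumFin (bit ∘ b)
length-selected {zero}  b q = refl
length-selected {suc a} b q with b zero
... | true  = cong suc (length-selected (b ∘ suc) (q ∘ suc))
... | false = length-selected (b ∘ suc) (q ∘ suc)

∈-selected : ∀ {a} (b : Fin a → Bool) q {i} → b i ≡ true → q i ∈ selected b q
∈-selected b q {zero} bᵢ with b zero
∈-selected b q {zero} refl | true = here refl
∈-selected b q {suc i} bᵢ with b zero
... | true  = there (∈-selected (b ∘ suc) (q ∘ suc) bᵢ)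
... | false = ∈-selected (b ∘ suc) (q ∘ suc) bᵢ

sumFin-cong : ∀ {a} {f g : Fin a → ℕ} → (∀ j → f j ≡ g j) → sumFin f ≡ sumFin g
sumFin-cong {zero}  f≡g = refl
sumFin-cong {suc a} f≡g = cong₂ _+_ (f≡g zero) (sumFin-cong (f≡g ∘ suc))

length-concat-tabulate : ∀ {a} (xs : Fin a → List A) → length (concat (tabulate xs)) ≡ sumFin (length ∘ xs)
length-concat-tabulate {a = zero}  xs = refl
length-concat-tabulate {a = suc a} xs =
  trans (length-++ (xs zero)) (cong (length (xs zero) +_) (length-concat-tabulate (xs ∘ suc)))

module _ {a} (sflag : ℕ → Bool) (q : Fin a → ℕ) where

  private
    hits : Fin a → List ℕ → List ℕ
    hits j = filter (T? ∘ inSj sflag q j)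

    ∈-hits⁻ : ∀ j xs {x} → x ∈ hits j xs → x ≡ q j ⊎ ∃ λ i → sflag (q i) ≡ true × x ≡ q i
    ∈-hits⁻ j xs x∈ = inSj⁻ sflag q (proj₂ (∈-filter⁻ (T? ∘ inSj sflag q j) {xs = xs} x∈))

  countᵇ-inSj≤ : ∀ j {xs} → Unique xs → countᵇ (inSj sflag q j) xs ≤ sOf sflag q + 1
  countᵇ-inSj≤ j {xs} unique = begin
    countᵇ (inSj sflag q j) xs                 ≡⟨ countᵇ≡length-filter _ xs ⟩
    length (hits j xs)                         ≤⟨ unique-⊆⇒length≤ (filter⁺ _ unique) hits⊆ ⟩
    suc (length (selected (sflag ∘ q) q))      ≡⟨ cong suc (length-selected (sflag ∘ q) q) ⟩
    suc (sOf sflag q)                          ≡⟨ +-comm 1 _ ⟩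
    sOf sflag q + 1                            ∎
    where
    open ≤-Reasoning
    hits⊆ : hits j xs ⊆ q j ∷ selected (sflag ∘ q) q
    hits⊆ x∈ with ∈-hits⁻ j xs x∈
    ... | inj₁ x≡qj              = here x≡qj
    ... | inj₂ (i , flag , refl) = there (∈-selected (sflag ∘ q) q flag)

  sumFin-countᵇ-inSj≤ : (xs : Fin a → List ℕ) → (∀ j → Unique (xs j)) →
    (∀ j j' → j ≢ j' → ∀ x → x ∈ xs j → x ∉ xs j') →
    sumFin (λ j → countᵇ (inSj sflag q j) (xs j)) ≤ a
  sumFin-countᵇ-inSj≤ xs unique disjoint = begin
    sumFin (λ j → countᵇ (inSj sflag q j) (xs j))  ≡⟨ sumFin-cong (λ j → countᵇ≡length-filter _ (xs j)) ⟩
    sumFin (λ j → length (hits j (xs j)))          ≡⟨ length-concat-tabulate (λ j → hits j (xs j)) ⟨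
    length (concat (tabulate (λ j → hits j (xs j)))) ≤⟨ unique-⊆⇒length≤ all-hits-unique all-hits⊆q ⟩
    length (tabulate q)                            ≡⟨ length-tabulate q ⟩
    a                                              ∎
    where
    open ≤-Reasoning
    all-hits-unique : Unique (concat (tabulate (λ j → hits j (xs j))))
    all-hits-unique = concat⁺
      (Allₚ.tabulate⁺ (λ j → filter⁺ _ (unique j)))
      (AllPairsₚ.tabulate⁺ (λ {j} {j'} j≢j' (x∈ , x∈′) →
        disjoint j j' j≢j' _ (proj₁ (∈-filter⁻ _ x∈)) (proj₁ (∈-filter⁻ _ x∈′))))
    all-hits⊆q : concat (tabulate (λ j → hits j (xs j))) ⊆ tabulate q
    all-hits⊆q x∈ with ∈-concat⁻′ (tabulate (λ j → hits j (xs j))) x∈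
    ... | ys , x∈ys , ys∈ with ∈-tabulate⁻ ys∈
    ... | j , refl with ∈-hits⁻ j (xs j) x∈ys
    ... | inj₁ refl              = ∈-tabulate⁺ j
    ... | inj₂ (i , _ , refl)    = ∈-tabulate⁺ i

CliqueColouring : (Fin m → List ℕ) → List ℕ → (Fin m → ℕ) → Set
CliqueColouring Lr F c = (∀ i → c i ∈ Lr i) × (∀ i → c i ∉ F) × Injective _≡_ _≡_ c

∷-cliqueColouring : ∀ {Lr : Fin (suc m) → List ℕ} {F y r} → y ∈ Lr zero → y ∉ F →
  CliqueColouring (Lr ∘ suc) (y ∷ F) r → CliqueColouring Lr F (y ∷ᶠ r)
∷-cliqueColouring {Lr = Lr} {F} {y} {r} y∈ y∉ (r∈ , r∉ , r-injective) = ∈Lr , ∉F , injective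
  where
  ∈Lr : ∀ i → (y ∷ᶠ r) i ∈ Lr i
  ∈Lr zero    = y∈
  ∈Lr (suc i) = r∈ i
  ∉F : ∀ i → (y ∷ᶠ r) i ∉ F
  ∉F zero    = y∉
  ∉F (suc i) = r∉ i ∘ there
  injective : Injective _≡_ _≡_ (y ∷ᶠ r)
  injective {zero}  {zero}   _ = refl
  injective {zero}  {suc i'} e = ⊥-elim (r∉ i' (here (sym e)))
  injective {suc i} {zero}   e = ⊥-elim (r∉ i (here e))
  injective {suc i} {suc i'} e = cong suc (r-injective e)

cliqueColourings : ∀ {ℓ} (Lr : Fin m → List ℕ) → (∀ i → Unique (Lr i)) → (∀ i → length (Lr i) ≡ ℓ) →
  ∀ F → Family (prodFrom (length F) m (ℓ ∸_)) _≗_ (CliqueColouring Lr F)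
cliqueColourings {zero} Lr _ _ F = family-one (λ ()) ((λ ()) , (λ ()) , λ { {()} })
cliqueColourings {suc m} {ℓ} Lr unique length≡ℓ F =
  family-map
    (family-Σ (family-≤ enough-colours (family-filter (_∉? F) (unique zero)))
              (λ {y} _ → cliqueColourings (Lr ∘ suc) (unique ∘ suc) (length≡ℓ ∘ suc) (y ∷ F)))
    (uncurry _∷ᶠ_) (λ e → e zero , e ∘ suc) (λ ((y∈ , y∉) , r) → ∷-cliqueColouring y∈ y∉ r)
  where
  enough-colours : ℓ ∸ length F ≤ length (filter (_∉? F) (Lr zero))
  enough-colours = begin
    ℓ ∸ length F
      ≤⟨ ∸-monoʳ-≤ ℓ (unique-⊆⇒length≤ (filter⁺ (_∈? F) (unique zero)) (proj₂ ∘ ∈-filter⁻ (_∈? F) {xs = Lr zero})) ⟩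
    ℓ ∸ length (filter (_∈? F) (Lr zero))
      ≡⟨ cong (_∸ length (filter (_∈? F) (Lr zero))) (length≡ℓ zero) ⟨
    length (Lr zero) ∸ length (filter (_∈? F) (Lr zero))
      ≡⟨ length-filter-∁ (_∈? F) (Lr zero) ⟨
    length (filter (_∉? F) (Lr zero))
      ∎
    where open ≤-Reasoning

prodFin-* : ∀ {a} (f g : Fin a → ℕ) → prodFin (λ j → f j * g j) ≡ prodFin f * prodFin g
prodFin-* {zero}  f g = refl
prodFin-* {suc a} f g = trans (cong (f zero * g zero *_) (prodFin-* (f ∘ suc) (g ∘ suc)))
                              (interchange (f zero) (g zero) _ _)

sumFin-bit≤ : ∀ {a} (b : Fin a → Bool) → sumFin (bit ∘ b) ≤ a
sumFin-bit≤ {zero}  b = z≤n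
sumFin-bit≤ {suc a} b with b zero
... | true  = s≤s (sumFin-bit≤ (b ∘ suc))
... | false = m≤n⇒m≤1+n (sumFin-bit≤ (b ∘ suc))

prodFin-bool : ∀ {a} (f : Bool → ℕ) (b : Fin a → Bool) →
  prodFin (f ∘ b) ≡ f true ^ sumFin (bit ∘ b) * f false ^ (a ∸ sumFin (bit ∘ b))
prodFin-bool {zero}  f b = refl
prodFin-bool {suc a} f b with b zero | prodFin-bool f (b ∘ suc) | sumFin-bit≤ (b ∘ suc)
... | true  | ih | _   = trans (cong (f true *_) ih) (sym (*-assoc (f true) _ _))
... | false | ih | s≤a = begin
  f false * prodFin (f ∘ b ∘ suc)                 ≡⟨ cong (f false *_) ih ⟩
  f false * (f true ^ s * f false ^ (a ∸ s))      ≡⟨ x∙yz≈y∙xz (f false) (f true ^ s) _ ⟩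
  f true ^ s * f false ^ suc (a ∸ s)              ≡⟨ cong (λ e → f true ^ s * f false ^ e) (+-∸-assoc 1 s≤a) ⟨
  f true ^ s * f false ^ (suc a ∸ s)              ∎
  where
  open ≡-Reasoning
  s = sumFin (bit ∘ b ∘ suc)

prodFrom-shift : ∀ lo k (f : ℕ → ℕ) → prodFrom lo k (f ∘ suc) ≡ prodFrom (suc lo) k f
prodFrom-shift lo zero    f = refl
prodFrom-shift lo (suc k) f = cong (f (suc lo) *_) (prodFrom-shift (suc lo) k f)

prodFrom-cong : ∀ lo k {f g : ℕ → ℕ} → (∀ i → i < lo + k → f i ≡ g i) → prodFrom lo k f ≡ prodFrom lo k g
prodFrom-cong lo zero    f≡g = refl
prodFrom-cong lo (suc k) f≡g =
  cong₂ _*_ (f≡g lo (subst (lo <_) (sym (+-suc lo k)) (s≤s (m≤m+n lo k))))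
            (prodFrom-cong (suc lo) k (λ i i< → f≡g i (subst (i <_) (sym (+-suc lo k)) i<)))

-- Choices for rows v₃,…,v_n of a column: v₂'s colour is excluded, and q_j too when s_{q_j} = 0.
lowerRowCount : ℕ → ℕ → Bool → ℕ
lowerRowCount ℓ m true  = prodFrom 1 m (ℓ ∸_)
lowerRowCount ℓ m false = prodFrom 2 m (ℓ ∸_)

lowerRowCount-true : ∀ m a →
  lowerRowCount (suc (m + a)) m true ≡ prodRange 3 (2 + m) (λ i → 2 + m + a ∸ i + 1)
lowerRowCount-true m a = begin
  prodFrom 1 m (suc (m + a) ∸_)             ≡⟨ prodFrom-cong 1 m 1+m+a∸i ⟩
  prodFrom 1 m (λ i → m + a ∸ i + 1)        ≡⟨ prodFrom-shift 1 m _ ⟩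
  prodFrom 2 m (λ i → suc (m + a) ∸ i + 1)  ≡⟨ prodFrom-shift 2 m _ ⟩
  prodFrom 3 m (λ i → 2 + m + a ∸ i + 1)    ∎
  where
  open ≡-Reasoning
  1+m+a∸i : ∀ i → i < 1 + m → suc (m + a) ∸ i ≡ m + a ∸ i + 1
  1+m+a∸i i (s≤s i≤m) = trans (+-∸-assoc 1 (≤-trans i≤m (m≤m+n m a))) (+-comm 1 _)

lowerRowCount-false : ∀ m a →
  lowerRowCount (suc (m + a)) m false ≡ prodRange 3 (2 + m) (λ i → 2 + m + a ∸ i)
lowerRowCount-false m a = prodFrom-shift 2 m (λ i → 2 + m + a ∸ i)

prodFin-columnCounts : ∀ m a (d : Fin a → ℕ) (b : Fin a → Bool) →
  prodFin (λ j → (suc (m + a) ∸ d j) * lowerRowCount (suc (m + a)) m (b j))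
    ≡ prodFin (λ j → suc (m + a) ∸ d j)
        * prodRange 3 (2 + m) (λ i → 2 + m + a ∸ i + 1) ^ sumFin (bit ∘ b)
        * prodRange 3 (2 + m) (λ i → 2 + m + a ∸ i) ^ (a ∸ sumFin (bit ∘ b))
prodFin-columnCounts m a d b = begin
  prodFin (λ j → free₂ j * rows (b j))                    ≡⟨ prodFin-* free₂ (rows ∘ b) ⟩
  prodFin free₂ * prodFin (rows ∘ b)                      ≡⟨ cong (prodFin free₂ *_) (prodFin-bool rows b) ⟩
  prodFin free₂ * (rows true ^ s * rows false ^ (a ∸ s))  ≡⟨ *-assoc (prodFin free₂) (rows true ^ s) _ ⟨
  prodFin free₂ * rows true ^ s * rows false ^ (a ∸ s)    ≡⟨ cong₂ (λ x y → prodFin free₂ * x ^ s * y ^ (a ∸ s))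
                                                                   (lowerRowCount-true m a) (lowerRowCount-false m a) ⟩
  prodFin free₂
    * prodRange 3 (2 + m) (λ i → 2 + m + a ∸ i + 1) ^ s
    * prodRange 3 (2 + m) (λ i → 2 + m + a ∸ i) ^ (a ∸ s) ∎
  where
  open ≡-Reasoning
  s = sumFin (bit ∘ b)
  free₂ : Fin a → ℕ
  free₂ j = suc (m + a) ∸ d j
  rows : Bool → ℕ
  rows = lowerRowCount (suc (m + a)) m

module Colourings {m a b ℓ} (L : Assignment (suc (suc m)) a b) (K : IsKAssignment ℓ L)
  (sflag : ℕ → Bool) (q : Fin a → ℕ) (q∈L : ∀ j → q j ∈ L zero (inj₁ j)) where

  two≤ : 2 ≤ suc (suc m)
  two≤ = s≤s (s≤s z≤n)

  d : Fin a → ℕ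
  d = dOf two≤ L sflag q

  record GoodColumn (j : Fin a) (col : Fin (suc (suc m)) → ℕ) : Set where
    field
      top             : col zero ≡ q j
      ∈lists          : ∀ i → col i ∈ L i (inj₁ j)
      second-free     : ¬ T (inSj sflag q j (col (suc zero)))
      lower-injective : Injective _≡_ _≡_ (col ∘ suc)
      lower-avoids    : sflag (q j) ≡ false → ∀ i → col (suc i) ≢ q j
  open GoodColumn

  edge-respected : (c : ColX (suc (suc m)) a) → (∀ j → GoodColumn j (λ i → c i j)) →
    ∀ {i j i' j'} → EdgeM two≤ sflag q (i , j) (i' , j') → c i j ≢ c i' j'
  edge-respected c good (clique0 {zero}  {zero}       _    i≢i') _ = i≢i' refl
  edge-respected c good (clique0 {zero}  {suc i'} {j} free _) e =
    lower-avoids (good j) free i' (trans (sym e) (top (good j)))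
  edge-respected c good (clique0 {suc i} {zero}   {j} free _) e =
    lower-avoids (good j) free i (trans e (top (good j)))
  edge-respected c good (clique0 {suc i} {suc i'} {j} _ i≢i') e =
    i≢i' (cong suc (lower-injective (good j) e))
  edge-respected c good (cross1 {j} {j'} flag _) e =
    second-free (good j') (subst (T ∘ inSj sflag q j') (trans (sym (top (good j))) e) (inSj⁺-flagged sflag q j' flag))
  edge-respected c good (clique1 {zero} _ i≢v₁ _ _) = ⊥-elim (i≢v₁ refl)
  edge-respected c good (clique1 {suc _} {zero} _ _ i'≢v₁ _) = ⊥-elim (i'≢v₁ refl)
  edge-respected c good (clique1 {suc i} {suc i'} {j} _ _ _ i≢i') e =
    i≢i' (cong suc (lower-injective (good j) e))

  goodColumns⇒InC'q : (c : ColX (suc (suc m)) a) → (∀ j → GoodColumn j (λ i → c i j)) → InC'q two≤ L sflag q c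
  goodColumns⇒InC'q c good = (λ i j → ∈lists (good j) i) , proper , (λ j → top (good j))
    where
    proper : IsProper (AdjM two≤ sflag q) c
    proper _ _ _ _ (inj₁ e) = edge-respected c good e
    proper _ _ _ _ (inj₂ e) eq = edge-respected c good e (sym eq)

  SecondColour : Fin a → ℕ → Set
  SecondColour j y = y ∈ L (suc zero) (inj₁ j) × ¬ T (inSj sflag q j y)

  secondColours : ∀ j → Family (ℓ ∸ d j) _≡_ (SecondColour j)
  secondColours j = subst (λ N → Family N _≡_ (SecondColour j)) count (family-filter free? (proj₁ (K _ _)))
    where
    L₂ = L (suc zero) (inj₁ j)
    free? = ∁? (T? ∘ inSj sflag q j)
    count : length (filter free? L₂) ≡ ℓ ∸ d j
    count = trans (length-filter-∁ (T? ∘ inSj sflag q j) L₂)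
                  (cong₂ _∸_ (proj₂ (K (suc zero) (inj₁ j))) (sym (countᵇ≡length-filter (inSj sflag q j) L₂)))

  columnsAvoiding : ∀ j R → (∀ {x} → x ∈ R → x ≡ q j) → (sflag (q j) ≡ false → q j ∈ R) →
    Family ((ℓ ∸ d j) * prodFrom (suc (length R)) m (ℓ ∸_)) _≗_ (GoodColumn j)
  columnsAvoiding j R R⊆qj qj∈R =
    family-map
      (family-Σ (secondColours j)
        (λ {y} _ → cliqueColourings Lr (λ _ → proj₁ (K _ _)) (λ _ → proj₂ (K _ _)) (y ∷ R)))
      (λ (y , r) → q j ∷ᶠ y ∷ᶠ r) (λ e → e (suc zero) , λ i → e (suc (suc i)))
      λ { {y , r} (y-ok , r-ok) → column y-ok r-ok }
    where
    Lr : Fin m → List ℕ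
    Lr i = L (suc (suc i)) (inj₁ j)
    column : ∀ {y r} → SecondColour j y →
      CliqueColouring Lr (y ∷ R) r → GoodColumn j (q j ∷ᶠ y ∷ᶠ r)
    column {y} {r} (y∈ , y-free) r-ok = record
      { top             = refl
      ; ∈lists          = λ { zero → q∈L j ; (suc i) → lower∈ i }
      ; second-free     = y-free
      ; lower-injective = lower-injective′
      ; lower-avoids    = λ flag i e → lower∉ i (subst (_∈ R) (sym e) (qj∈R flag))
      }
      where
      y∉R : y ∉ R
      y∉R y∈R = y-free (subst (T ∘ inSj sflag q j) (sym (R⊆qj y∈R)) (inSj⁺-self sflag q j))
      lower = ∷-cliqueColouring {Lr = λ i → L (suc i) (inj₁ j)} y∈ y∉R r-ok
      lower∈ = proj₁ lower
      lower∉ = proj₁ (proj₂ lower)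
      lower-injective′ = proj₂ (proj₂ lower)

  column : ∀ j → Family ((ℓ ∸ d j) * lowerRowCount ℓ m (sflag (q j))) _≗_ (GoodColumn j)
  column j with sflag (q j) in flag
  ... | true  = columnsAvoiding j [] (λ ()) (λ unflagged → contradiction (trans (sym flag) unflagged) λ ())
  ... | false = columnsAvoiding j (q j ∷ []) (λ { (here e) → e }) (λ _ → here refl)

  colourings : AtLeast (prodFin (λ j → (ℓ ∸ d j) * lowerRowCount ℓ m (sflag (q j)))) (InC'q two≤ L sflag q)
  colourings with family f good distinct ← family-columns column =
    f , (λ k → goodColumns⇒InC'q (f k) (good k)) , distinct

-- The construction works for any flag function.
lemma20 : (n a : ℕ) (h : 2 ≤ n) → n ≤ a →
    (L : Assignment n a (bSize n a)) → IsKAssignment (n + a ∸ 1) L → XListsDisjoint L →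
    (sflag : ℕ → Bool) → IsSIndicator L sflag →
    (q : Fin a → ℕ) → (∀ j → q j ∈ L (v₁ h) (inj₁ j)) →
    ((∀ j → dOf h L sflag q j ≤ sOf sflag q + 1) × sumFin (dOf h L sflag q) ≤ a)
    × AtLeast
        (prodFin (λ j → n + a ∸ 1 ∸ dOf h L sflag q j)
          * (prodRange 3 n (λ i → n + a ∸ i + 1)) ^ sOf sflag q
          * (prodRange 3 n (λ i → n + a ∸ i)) ^ (a ∸ sOf sflag q))
        (InC'q h L sflag q)
lemma20 (suc (suc m)) a (s≤s (s≤s z≤n)) _ L K disjoint sflag _ q q∈L =
  ( (λ j → countᵇ-inSj≤ sflag q j (unique₂ j))
  , sumFin-countᵇ-inSj≤ sflag q (λ j → L (suc zero) (inj₁ j)) unique₂ (disjoint (suc zero)) )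
  , subst (λ N → AtLeast N (InC'q two≤ L sflag q)) (prodFin-columnCounts m a d (sflag ∘ q)) colourings
  where
  open Colourings L K sflag q q∈L
  unique₂ : ∀ j → Unique (L (suc zero) (inj₁ j))
  unique₂ j = proj₁ (K (suc zero) (inj₁ j))
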